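{- Let $q\geq 2$ be an integer and let $\mathcal{A}$ be an affine plane of order $q$. Let $\mathcal{L}$ be a set of $q+1$ pairwise non-parallel lines of $\mathcal{A}$ and let $\mathcal{K}$ be the Kakeya set determined by $\mathcal{L}$. Put $\kappa=\sqrt{q+\tfrac14}-\tfrac12$. If $$|\mathcal{K}|> q^2-\min\left\{\lceil\kappa\rceil\left(q-\lceil\kappa\rceil\right),\ \frac{q\left(q-\lfloor\kappa\rfloor\right)}{\lfloor\kappa\rfloor+1}\right\},$$ then $\mathcal{K}$ contains a $(q+1-k)$-knot for some integer $k$ with $0\leq k<\lceil\kappa\rceil$, and $$|\mathcal{K}|\in\left[q^2-kq+\frac{k(k+1)}{2},\ q^2-kq+k^2\right].$$
   Context: An affine plane of order $q$ is a set of $q^2$ points and $q^2+q$ lines (each line a set of $q$ points) such that any two points lie on exactly one line and any two lines meet in at most one point; its lines are partitioned into $q+1$ parallel classes, each consisting of $q$ pairwise disjoint lines. A Kakeya set is the set $\mathcal{K}$ of points covered by a set $\mathcal{L}$ of $q+1$ lines containing exactly one line from each parallel class (equivalently, $q+1$ pairwise non-parallel lines). For an integer $j$, a $j$-knot of $\mathcal{K}$ is a point lying on exactly $j$ lines of $\mathcal{L}$. -}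

module Defs where

open import Data.Nat using (ℕ; zero; suc; _+_; _*_; _∸_; _<_; _≤_)
open import Data.Nat using () renaming (_≤ᵇ_ to _≤ᵇ_; _<ᵇ_ to _<ᵇ_)
open import Data.Bool using (Bool; true; false; if_then_else_; _∨_)
open import Data.Fin using (Fin; zero; suc; _≟_)
open import Data.Product using (Σ; _×_; _,_; ∃)
open import Relation.Binary.PropositionalEquality using (_≡_; _≢_)
open import Relation.Nullary using (¬_)
open import Relation.Nullary.Decidable using (⌊_⌋)

count : {n : ℕ} → (Fin n → Bool) → ℕ
count {zero}  P = 0
count {suc n} P = (if P zero then 1 else 0) + count (λ i → P (suc i))

anyFin : {n : ℕ} → (Fin n → Bool) → Bool
anyFin {zero}  P = false
anyFin {suc n} P = P zero ∨ anyFin (λ i → P (suc i))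

countBelow : ℕ → (ℕ → Bool) → ℕ
countBelow zero    P = 0
countBelow (suc n) P = countBelow n P + (if P n then 1 else 0)

-- κ = sqrt(q + 1/4) - 1/2 is the nonnegative root of x² + x = q.
-- ⌊κ⌋ = largest m ≥ 0 with m(m+1) ≤ q  = #{ m ∈ {1..q} : m(m+1) ≤ q }
floorκ : ℕ → ℕ
floorκ q = countBelow q (λ m → (suc m * (suc m + 1)) ≤ᵇ q)

-- ⌈κ⌉ = least m ≥ 0 with m(m+1) ≥ q  = #{ m ∈ {0..q} : m(m+1) < q }
ceilκ : ℕ → ℕ
ceilκ q = countBelow (suc q) (λ m → (m * (m + 1)) <ᵇ q)

record AffinePlane (q : ℕ) : Set where
  field
    I : Fin (q * q) → Fin (q * q + q) → Bool
    lineSize : ∀ l → count (λ p → I p l) ≡ q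
    joinExists : ∀ p p′ → p ≢ p′ →
      Σ (Fin (q * q + q)) λ l → (I p l ≡ true) × (I p′ l ≡ true)
    joinUnique : ∀ p p′ → p ≢ p′ → ∀ l l′ →
      I p l ≡ true → I p′ l ≡ true → I p l′ ≡ true → I p′ l′ ≡ true → l ≡ l′
    meetAtMostOne : ∀ l l′ → l ≢ l′ → ∀ p p′ →
      I p l ≡ true → I p l′ ≡ true → I p′ l ≡ true → I p′ l′ ≡ true → p ≡ p′
    parClass : Fin (q * q + q) → Fin (suc q)
    classSize : ∀ c → count (λ l → ⌊ parClass l ≟ c ⌋) ≡ q
    classDisjoint : ∀ l l′ → parClass l ≡ parClass l′ → l ≢ l′ →
      ∀ p → ¬ ((I p l ≡ true) × (I p l′ ≡ true))

  Point : Set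
  Point = Fin (q * q)

  Line : Set
  Line = Fin (q * q + q)

  Parallel : Line → Line → Set
  Parallel l l′ = parClass l ≡ parClass l′

  PairwiseNonParallel : (Fin (suc q) → Line) → Set
  PairwiseNonParallel L = ∀ i j → i ≢ j → ¬ Parallel (L i) (L j)

  inKakeya : (Fin (suc q) → Line) → Point → Bool
  inKakeya L p = anyFin (λ i → I p (L i))

  kakeyaSize : (Fin (suc q) → Line) → ℕ
  kakeyaSize L = count (inKakeya L)

  multiplicity : (Fin (suc q) → Line) → Point → ℕ
  multiplicity L p = count (λ i → I p (L i))

  IsKnot : (Fin (suc q) → Line) → ℕ → Point → Set
  IsKnot L j p = multiplicity L p ≡ j

module Submission where

-- Let p₀ be a point on the largest number M = q + 1 − k of lines of L; it is the required knot.
-- Distinct lines of L meet exactly once, so the incidence vectors χᵢ of the lines have Gram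
-- matrix J + (q − 1) I: for weights u, v on L and mᵤ(p) = Σᵢ uᵢ χᵢ(p),
-- Σₚ mᵤ mᵥ = Σ u Σ v + (q − 1) Σ uᵢ vᵢ. Hence Σₚ m = q(q + 1) and Σₚ m² = 2q(q + 1) for the
-- multiplicity m, and Σₚ s r = M k for the multiplicities s and r with respect to the lines
-- through p₀ and the other lines. Summing pointwise inequalities for |K| = Σₚ min(m, 1):
--   min(s + r, 1) + s r ≤ s + r off p₀, where s ≤ 1, gives |K| ≤ q² − kq + k²;
--   3m ≤ 2 min(m, 1) + m², whose slack at p₀ is (M − 1)(M − 2),
--   gives 2|K| ≥ 2q² − 2kq + k(k + 1);
--   m² + M min(m, 1) ≤ (M + 1) m gives M |K| ≤ (M − 1) q(q + 1).
-- The last bound contradicts the second hypothesis unless M > ⌊κ⌋ + 1 ≥ ⌈κ⌉, and then k ≥ ⌈κ⌉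
-- would give ⌈κ⌉ ≤ k ≤ q − ⌈κ⌉, where |K| ≤ q² − k(q − k) ≤ q² − ⌈κ⌉(q − ⌈κ⌉)
-- contradicts the first.

open import Defs
open import Data.Nat using (ℕ; suc; _+_; _*_; _∸_; _<_; _≤_)
open import Data.Product using (Σ; _×_)
open import Data.Fin using (Fin)
open import Data.Bool using (true)
open import Relation.Binary.PropositionalEquality using (_≡_)

open import Data.Nat using (zero; pred; _⊓_; z≤n; s≤s; _≤?_; _<ᵇ_; _≤ᵇ_; >-nonZero)
open import Data.Nat.Properties hiding (_≟_)
open import Data.Nat.Tactic.RingSolver using (solve; solve-∀)
open import Data.Bool using (Bool; false; not; if_then_else_; T)
open import Data.Bool.Properties using (T-≡)
open import Data.Fin using (zero; suc; _≟_; punchIn)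
open import Data.List using (_∷_; [])
open import Data.Fin.Properties using (punchInᵢ≢i)
import Data.Fin.Properties as Fin
open import Data.Product using (∃; _,_; proj₁; proj₂)
open import Data.Unit using (tt)
open import Data.Empty using (⊥-elim)
open import Function using (_∘_; Equivalence)
open import Relation.Binary.PropositionalEquality
  using (_≢_; refl; sym; trans; cong; cong₂; subst; subst₂; module ≡-Reasoning)
open import Relation.Nullary using (¬_; yes; no)
open import Relation.Nullary.Decidable
  using (⌊_⌋; toWitness; decidable-stable; dec-true; isYes≗does)
open import Algebra.Properties.Semiring.Sum +-*-semiring
  using (sum; sum-syntax; sum-cong-≗; sum-remove; sum-replicate-zero;
         ∑-distrib-+; ∑-comm; *-distribˡ-sum; *-distribʳ-sum)

-- Finite sums over Fin n

𝟙 : Bool → ℕ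
𝟙 b = if b then 1 else 0

𝟙≤1 : ∀ b → 𝟙 b ≤ 1
𝟙≤1 true  = ≤-refl
𝟙≤1 false = z≤n

𝟙-mono : ∀ {x y} → (T x → T y) → 𝟙 x ≤ 𝟙 y
𝟙-mono {false}         _   = z≤n
𝟙-mono {true}  {true}  _   = ≤-refl
𝟙-mono {true}  {false} x⇒y = ⊥-elim (x⇒y tt)

𝟙*𝟙≡𝟙 : ∀ b → 𝟙 b * 𝟙 b ≡ 𝟙 b
𝟙*𝟙≡𝟙 true  = refl
𝟙*𝟙≡𝟙 false = refl

𝟙+𝟙[not]≡1 : ∀ b → 𝟙 b + 𝟙 (not b) ≡ 1
𝟙+𝟙[not]≡1 true  = refl
𝟙+𝟙[not]≡1 false = refl

𝟙*𝟙[not]≡0 : ∀ b → 𝟙 b * 𝟙 (not b) ≡ 0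
𝟙*𝟙[not]≡0 true  = refl
𝟙*𝟙[not]≡0 false = refl

𝟙≡1⇒≡true : ∀ {b} → 𝟙 b ≡ 1 → b ≡ true
𝟙≡1⇒≡true {true} _ = refl

≟-sound : ∀ {n} {x y : Fin n} → ⌊ x ≟ y ⌋ ≡ true → x ≡ y
≟-sound e = toWitness (Equivalence.from T-≡ e)

≟-self : ∀ {n} (x : Fin n) → ⌊ x ≟ x ⌋ ≡ true
≟-self x = trans (isYes≗does (x ≟ x)) (dec-true (x ≟ x) refl)

suc⊓1≡1 : ∀ n → suc n ⊓ 1 ≡ 1
suc⊓1≡1 n = m≥n⇒m⊓n≡n (s≤s z≤n)

count≡∑ : ∀ {n} (P : Fin n → Bool) → count P ≡ ∑[ i < n ] 𝟙 (P i)
count≡∑ {zero}  P = refl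
count≡∑ {suc n} P = cong (𝟙 (P zero) +_) (count≡∑ (P ∘ suc))

𝟙[anyFin]≡count⊓1 : ∀ {n} (P : Fin n → Bool) → 𝟙 (anyFin P) ≡ count P ⊓ 1
𝟙[anyFin]≡count⊓1 {zero}  P = refl
𝟙[anyFin]≡count⊓1 {suc n} P with P zero
... | true  = sym (suc⊓1≡1 (count (P ∘ suc)))
... | false = 𝟙[anyFin]≡count⊓1 (P ∘ suc)

∑-const : ∀ n c → ∑[ i < n ] c ≡ n * c
∑-const zero    c = refl
∑-const (suc n) c = cong (c +_) (∑-const n c)

∑-mono-≤ : ∀ {n} {f g : Fin n → ℕ} → (∀ i → f i ≤ g i) → sum f ≤ sum g
∑-mono-≤ {zero}  _   = z≤n
∑-mono-≤ {suc n} f≤g = +-mono-≤ (f≤g zero) (∑-mono-≤ (f≤g ∘ suc))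

∑-mono-≤-except : ∀ {n} {f g : Fin n → ℕ} j {d e} →
  (∀ i → i ≢ j → f i ≤ g i) → f j + d ≤ g j + e → sum f + d ≤ sum g + e
∑-mono-≤-except {suc n} {f} {g} j {d} {e} f≤g at-j = begin
  sum f + d                           ≡⟨ cong (_+ d) (sum-remove {i = j} f) ⟩
  f j + ∑[ i < n ] f (punchIn j i) + d ≡⟨ swap (f j) _ d ⟩
  (f j + d) + ∑[ i < n ] f (punchIn j i)
    ≤⟨ +-mono-≤ at-j (∑-mono-≤ (λ i → f≤g (punchIn j i) (punchInᵢ≢i j i))) ⟩
  (g j + e) + ∑[ i < n ] g (punchIn j i) ≡⟨ swap (g j) _ e ⟨
  g j + ∑[ i < n ] g (punchIn j i) + e ≡⟨ cong (_+ e) (sum-remove {i = j} g) ⟨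
  sum g + e                           ∎
  where
  open ≤-Reasoning
  swap : ∀ x y z → x + y + z ≡ (x + z) + y
  swap = solve-∀

≤-pointwise∧∑≡⇒≗ : ∀ {n} {f g : Fin n → ℕ} →
  (∀ i → f i ≤ g i) → sum f ≡ sum g → ∀ i → f i ≡ g i
≤-pointwise∧∑≡⇒≗ {suc n} {f} {g} f≤g ∑f≡∑g = pointwise
  where
  rest≤ : sum (f ∘ suc) ≤ sum (g ∘ suc)
  rest≤ = ∑-mono-≤ (f≤g ∘ suc)
  head≡ : f zero ≡ g zero
  head≡ = ≤-antisym (f≤g zero) (+-cancelʳ-≤ (sum (f ∘ suc)) (g zero) (f zero)
    (≤-trans (+-monoʳ-≤ (g zero) rest≤) (≤-reflexive (sym ∑f≡∑g))))
  rest≡ : sum (f ∘ suc) ≡ sum (g ∘ suc)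
  rest≡ = +-cancelˡ-≡ (f zero) _ _ (trans ∑f≡∑g (cong (_+ sum (g ∘ suc)) (sym head≡)))
  pointwise : ∀ i → f i ≡ g i
  pointwise zero    = head≡
  pointwise (suc i) = ≤-pointwise∧∑≡⇒≗ (f≤g ∘ suc) rest≡ i

∑𝟙*𝟙≤1 : ∀ {n} (P Q : Fin n → Bool) →
  (∀ {i j} → P i ≡ true → Q i ≡ true → P j ≡ true → Q j ≡ true → i ≡ j) →
  ∑[ i < n ] (𝟙 (P i) * 𝟙 (Q i)) ≤ 1
∑𝟙*𝟙≤1 {zero}  P Q unique = z≤n
∑𝟙*𝟙≤1 {suc n} P Q unique with P zero in P₀ | Q zero in Q₀
... | true  | true  = ≤-reflexive (cong suc rest≡0)
  where
  rest≡0 : ∑[ i < n ] (𝟙 (P (suc i)) * 𝟙 (Q (suc i))) ≡ 0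
  rest≡0 = trans (sum-cong-≗ term≡0) (sum-replicate-zero n)
    where
    term≡0 : ∀ i → 𝟙 (P (suc i)) * 𝟙 (Q (suc i)) ≡ 0
    term≡0 i with P (suc i) in Pᵢ | Q (suc i) in Qᵢ
    ... | true  | true  = ⊥-elim (Fin.0≢1+n (unique P₀ Q₀ Pᵢ Qᵢ))
    ... | true  | false = refl
    ... | false | _     = refl
... | true  | false = ∑𝟙*𝟙≤1 (P ∘ suc) (Q ∘ suc)
                        λ p q p′ q′ → Fin.suc-injective (unique p q p′ q′)
... | false | _     = ∑𝟙*𝟙≤1 (P ∘ suc) (Q ∘ suc)
                        λ p q p′ q′ → Fin.suc-injective (unique p q p′ q′)

∑-*-∑-comm : ∀ {m n} (x : Fin m → ℕ) (y : Fin n → ℕ) (z : Fin m → Fin n → ℕ) →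
  ∑[ i < m ] (x i * ∑[ j < n ] (y j * z i j)) ≡ ∑[ j < n ] (y j * ∑[ i < m ] (x i * z i j))
∑-*-∑-comm {m} {n} x y z = begin
  ∑[ i < m ] (x i * ∑[ j < n ] (y j * z i j))
    ≡⟨ sum-cong-≗ (λ i → *-distribˡ-sum (x i) (λ j → y j * z i j)) ⟩
  ∑[ i < m ] ∑[ j < n ] (x i * (y j * z i j))
    ≡⟨ sum-cong-≗ (λ i → sum-cong-≗ (λ j → exchange (x i) (y j) (z i j))) ⟩
  ∑[ i < m ] ∑[ j < n ] (y j * (x i * z i j))
    ≡⟨ ∑-comm (λ i j → y j * (x i * z i j)) ⟩
  ∑[ j < n ] ∑[ i < m ] (y j * (x i * z i j))
    ≡⟨ sum-cong-≗ (λ j → *-distribˡ-sum (y j) (λ i → x i * z i j)) ⟨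
  ∑[ j < n ] (y j * ∑[ i < m ] (x i * z i j)) ∎
  where
  open ≡-Reasoning
  exchange : ∀ a b c → a * (b * c) ≡ b * (a * c)
  exchange = solve-∀

argmax : ∀ {n} (f : Fin (suc n) → ℕ) → ∃ λ p → ∀ x → f x ≤ f p
argmax {zero}  f = zero , λ { zero → ≤-refl }
argmax {suc n} f with argmax (f ∘ suc)
... | p , max with f zero ≤? f (suc p)
...   | yes f₀≤ = suc p , λ { zero → f₀≤ ; (suc x) → max x }
...   | no  f₀≰ = zero , λ { zero → ≤-refl
                           ; (suc x) → ≤-trans (max x) (<⇒≤ (≰⇒> f₀≰)) }

-- The integers ⌊κ⌋ and ⌈κ⌉

countBelow-suc : ∀ n P → countBelow (suc n) P ≡ 𝟙 (P 0) + countBelow n (P ∘ suc)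
countBelow-suc zero    P = sym (+-identityʳ (𝟙 (P 0)))
countBelow-suc (suc n) P =
  trans (cong (_+ 𝟙 (P (suc n))) (countBelow-suc n P)) (+-assoc (𝟙 (P 0)) _ _)

countBelow-mono : ∀ n {P Q} → (∀ m → T (P m) → T (Q m)) → countBelow n P ≤ countBelow n Q
countBelow-mono zero    P⇒Q = z≤n
countBelow-mono (suc n) P⇒Q = +-mono-≤ (countBelow-mono n P⇒Q) (𝟙-mono (P⇒Q n))

countBelow≤ : ∀ n P → countBelow n P ≤ n
countBelow≤ zero    P = z≤n
countBelow≤ (suc n) P =
  subst (_≤ suc n) (+-comm (𝟙 (P n)) _) (+-mono-≤ (𝟙≤1 (P n)) (countBelow≤ n P))

floorκ≤ : ∀ q → floorκ q ≤ q
floorκ≤ q = countBelow≤ q _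

ceilκ≤1+floorκ : ∀ q → ceilκ q ≤ suc (floorκ q)
ceilκ≤1+floorκ q = begin
  ceilκ q
    ≡⟨ countBelow-suc q _ ⟩
  𝟙 (0 <ᵇ q) + countBelow q (λ m → suc m * (suc m + 1) <ᵇ q)
    ≤⟨ +-mono-≤ (𝟙≤1 _) (countBelow-mono q <ᵇ⇒≤ᵇ) ⟩
  1 + floorκ q ∎
  where
  open ≤-Reasoning
  <ᵇ⇒≤ᵇ : ∀ m → T (suc m * (suc m + 1) <ᵇ q) → T (suc m * (suc m + 1) ≤ᵇ q)
  <ᵇ⇒≤ᵇ m lt = ≤⇒≤ᵇ (<⇒≤ (<ᵇ⇒< _ q lt))

-- Inequalities between natural numbers

n≤n*n : ∀ n → n ≤ n * n
n≤n*n zero    = z≤n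
n≤n*n (suc n) = m≤m*n (suc n) (suc n)

[s+r]⊓1+s*r≤s+r : ∀ {s} r → s ≤ 1 → (s + r) ⊓ 1 + s * r ≤ s + r
[s+r]⊓1+s*r≤s+r r z≤n       = ≤-trans (≤-reflexive (+-identityʳ (r ⊓ 1))) (m⊓n≤m r 1)
[s+r]⊓1+s*r≤s+r r (s≤s z≤n) = ≤-reflexive (cong₂ _+_ (suc⊓1≡1 r) (+-identityʳ r))

3*m≤2*[m⊓1]+m*m : ∀ m → 3 * m ≤ 2 * (m ⊓ 1) + m * m
3*m≤2*[m⊓1]+m*m zero    = z≤n
3*m≤2*[m⊓1]+m*m (suc n) = begin
  3 * suc n                       ≡⟨ solve (n ∷ []) ⟩
  3 + 2 * n + n                   ≤⟨ +-monoʳ-≤ (3 + 2 * n) (n≤n*n n) ⟩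
  3 + 2 * n + n * n               ≡⟨ solve (n ∷ []) ⟩
  2 * 1 + suc n * suc n           ≡⟨ cong (λ x → 2 * x + suc n * suc n) (suc⊓1≡1 n) ⟨
  2 * (suc n ⊓ 1) + suc n * suc n ∎
  where open ≤-Reasoning

m*m+M*[m⊓1]≤[1+M]*m : ∀ {m M} → m ≤ M → m * m + M * (m ⊓ 1) ≤ suc M * m
m*m+M*[m⊓1]≤[1+M]*m {zero}  {M} _   = ≤-refl
m*m+M*[m⊓1]≤[1+M]*m {suc t} {M} t<M = begin
  suc t * suc t + M * (suc t ⊓ 1) ≡⟨ cong (λ x → suc t * suc t + M * x) (suc⊓1≡1 t) ⟩
  suc t * suc t + M * 1           ≡⟨ solve (t ∷ M ∷ []) ⟩
  t * suc t + (suc t + M)         ≤⟨ +-monoˡ-≤ (suc t + M) (*-monoʳ-≤ t t<M) ⟩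
  t * M + (suc t + M)             ≡⟨ solve (t ∷ M ∷ []) ⟩
  suc M * suc t                   ∎
  where open ≤-Reasoning

upperBound-arith : ∀ {a k q K} → a + k ≡ q →
  K + suc a * k + a ≤ suc a * q + k * q → K + k * q ≤ q * q + k * k
upperBound-arith {a} {k} {_} {K} refl h = begin
  K + k * (a + k)                           ≤⟨ +-monoˡ-≤ (k * (a + k)) K≤X ⟩
  (a * a + a * k + k * k) + k * (a + k)     ≡⟨ solve (a ∷ k ∷ []) ⟩
  (a + k) * (a + k) + k * k                 ∎
  where
  open ≤-Reasoning
  K≤X : K ≤ a * a + a * k + k * k
  K≤X = +-cancelʳ-≤ (suc a * k + a) K _ (subst₂ _≤_ (+-assoc K (suc a * k) a) (e a k) h)
    where
    e : ∀ a k → suc a * (a + k) + k * (a + k) ≡ (a * a + a * k + k * k) + (suc a * k + a)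
    e = solve-∀

lowerBound-arith : ∀ {a k q K} → a + k ≡ q →
  3 * (suc q * q) + a * a ≤ 2 * K + (suc q * q + suc q * q) + a →
  2 * (q * q) + k * (k + 1) ≤ 2 * K + 2 * (k * q)
lowerBound-arith {a} {k} {_} {K} refl h = begin
  2 * ((a + k) * (a + k)) + k * (k + 1)              ≡⟨ solve (a ∷ k ∷ []) ⟩
  (2 * (a * a) + 2 * (a * k) + k * k + k) + 2 * (k * (a + k))
    ≤⟨ +-monoˡ-≤ (2 * (k * (a + k))) Y≤2K ⟩
  2 * K + 2 * (k * (a + k))                          ∎
  where
  open ≤-Reasoning
  Y≤2K : 2 * (a * a) + 2 * (a * k) + k * k + k ≤ 2 * K
  Y≤2K = +-cancelʳ-≤ (a + 2 * (suc (a + k) * (a + k))) _ _ (subst₂ _≤_ (e₁ a k) (e₂ a k K) h)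
    where
    e₁ : ∀ a k → 3 * (suc (a + k) * (a + k)) + a * a
                 ≡ (2 * (a * a) + 2 * (a * k) + k * k + k) + (a + 2 * (suc (a + k) * (a + k)))
    e₁ = solve-∀
    e₂ : ∀ a k K → 2 * K + (suc (a + k) * (a + k) + suc (a + k) * (a + k)) + a
                   ≡ 2 * K + (a + 2 * (suc (a + k) * (a + k)))
    e₂ = solve-∀

K*[1+a]≤S*a : ∀ {S K a} → S + S + suc a * K ≤ suc (suc a) * S → K * suc a ≤ S * a
K*[1+a]≤S*a {S} {K} {a} h = +-cancelˡ-≤ (S + S) _ _ (subst₂ _≤_ (e₁ S K a) (e₂ S a) h)
  where
  e₁ : ∀ S K a → S + S + suc a * K ≡ S + S + K * suc a
  e₁ = solve-∀
  e₂ : ∀ S a → suc (suc a) * S ≡ S + S + S * a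
  e₂ = solve-∀

x*[1+a]≤y*a⇒x*[f+1]≤y*f : ∀ x y {a f} → x * suc a ≤ y * a → a ≤ f → x * (f + 1) ≤ y * f
x*[1+a]≤y*a⇒x*[f+1]≤y*f x y {a} {f} h a≤f = *-cancelˡ-≤ (suc a) (begin
  suc a * (x * (f + 1))  ≡⟨ solve (x ∷ a ∷ f ∷ []) ⟩
  x * suc a * (f + 1)    ≤⟨ *-monoˡ-≤ (f + 1) h ⟩
  y * a * (f + 1)        ≡⟨ solve (y ∷ a ∷ f ∷ []) ⟩
  y * (a * f + a)        ≤⟨ *-monoʳ-≤ y (+-monoʳ-≤ (a * f) a≤f) ⟩
  y * (a * f + f)        ≡⟨ solve (y ∷ a ∷ f ∷ []) ⟩
  suc a * (y * f)        ∎)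
  where open ≤-Reasoning

[1+q]*q*f+q*[q∸f]≡q*q*[f+1] : ∀ {q f} → f ≤ q → suc q * q * f + q * (q ∸ f) ≡ q * q * (f + 1)
[1+q]*q*f+q*[q∸f]≡q*q*[f+1] {q} {f} f≤q with q ∸ f | m+[n∸m]≡n f≤q
... | g | refl = solve (f ∷ g ∷ [])

c*[q∸c]≤k*[q∸k] : ∀ {c k q} → c ≤ k → k + c ≤ q → c * (q ∸ c) ≤ k * (q ∸ k)
c*[q∸c]≤k*[q∸k] {c} {k} {q} c≤k k+c≤q
  with k ∸ c | m+[n∸m]≡n c≤k | q ∸ k | m+[n∸m]≡n (m+n≤o⇒m≤o k k+c≤q)
... | d | refl | u | refl = begin
  c * ((c + d) + u ∸ c)  ≡⟨ cong (c *_) (trans (cong (_∸ c) (+-assoc c d u)) (m+n∸m≡n c (d + u))) ⟩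
  c * (d + u)            ≡⟨ solve (c ∷ d ∷ u ∷ []) ⟩
  c * d + c * u          ≤⟨ +-monoˡ-≤ (c * u) (*-monoˡ-≤ d c≤u) ⟩
  u * d + c * u          ≡⟨ solve (c ∷ d ∷ u ∷ []) ⟩
  (c + d) * u            ∎
  where
  open ≤-Reasoning
  c≤u : c ≤ u
  c≤u = +-cancelˡ-≤ (c + d) c u k+c≤q

K+k*[q∸k]≤q*q : ∀ {K k q} → k ≤ q → K + k * q ≤ q * q + k * k → K + k * (q ∸ k) ≤ q * q
K+k*[q∸k]≤q*q {K} {k} {q} k≤q h with q ∸ k | m+[n∸m]≡n k≤q
... | u | refl = +-cancelʳ-≤ (k * k) _ _ (subst (_≤ (k + u) * (k + u) + k * k) (e K k u) h)
  where
  e : ∀ K k u → K + k * (k + u) ≡ K + k * u + k * k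
  e = solve-∀

[s+r]⊓1+s*r+a≤s+r+0 : ∀ {s r a} → s ≡ suc a → r ≡ 0 → (s + r) ⊓ 1 + s * r + a ≤ s + r + 0
[s+r]⊓1+s*r+a≤s+r+0 {a = a} refl refl = ≤-reflexive (begin
  (suc a + 0) ⊓ 1 + suc a * 0 + a ≡⟨ cong (λ x → x + suc a * 0 + a) (suc⊓1≡1 (a + 0)) ⟩
  1 + suc a * 0 + a               ≡⟨ solve (a ∷ []) ⟩
  suc a + 0 + 0                   ∎)
  where open ≡-Reasoning

3*m+a*a≤2*[m⊓1]+m*m+a : ∀ {m a} → m ≡ suc a → 3 * m + a * a ≤ 2 * (m ⊓ 1) + m * m + a
3*m+a*a≤2*[m⊓1]+m*m+a {a = a} refl = ≤-reflexive (begin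
  3 * suc a + a * a                   ≡⟨ solve (a ∷ []) ⟩
  2 * 1 + suc a * suc a + a           ≡⟨ cong (λ x → 2 * x + suc a * suc a + a) (suc⊓1≡1 a) ⟨
  2 * (suc a ⊓ 1) + suc a * suc a + a ∎)
  where open ≡-Reasoning

-- Counting in an affine plane

module _ {q : ℕ} (A : AffinePlane q) where
  open AffinePlane A

  inc : Point → Line → ℕ
  inc p l = 𝟙 (I p l)

  inClass : Fin (suc q) → Line → ℕ
  inClass C l = 𝟙 ⌊ parClass l ≟ C ⌋

  ∑-inc : ∀ l → ∑[ p < q * q ] inc p l ≡ q
  ∑-inc l = trans (sym (count≡∑ (λ p → I p l))) (lineSize l)

  ∑-inClass : ∀ C → ∑[ l < q * q + q ] inClass C l ≡ q
  ∑-inClass C = trans (sym (count≡∑ (λ l → ⌊ parClass l ≟ C ⌋))) (classSize C)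

  ∑-inc*inc-self : ∀ l → ∑[ p < q * q ] (inc p l * inc p l) ≡ q
  ∑-inc*inc-self l = trans (sum-cong-≗ (λ p → 𝟙*𝟙≡𝟙 (I p l))) (∑-inc l)

  ∑-inClass*inc≤1 : ∀ C p → ∑[ l < q * q + q ] (inClass C l * inc p l) ≤ 1
  ∑-inClass*inc≤1 C p = ∑𝟙*𝟙≤1 (λ l → ⌊ parClass l ≟ C ⌋) (λ l → I p l) same-line
    where
    same-line : ∀ {l l′} → ⌊ parClass l ≟ C ⌋ ≡ true → I p l ≡ true →
                ⌊ parClass l′ ≟ C ⌋ ≡ true → I p l′ ≡ true → l ≡ l′
    same-line {l} {l′} l∈C p∈l l′∈C p∈l′ = decidable-stable (l ≟ l′) λ l≢l′ →
      classDisjoint l l′ (trans (≟-sound l∈C) (sym (≟-sound l′∈C))) l≢l′ p (p∈l , p∈l′)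

  -- The q pairwise disjoint lines of a class carry q · q incidences, at most one per point.
  ∑-inClass*inc≡1 : ∀ C p → ∑[ l < q * q + q ] (inClass C l * inc p l) ≡ 1
  ∑-inClass*inc≡1 C = ≤-pointwise∧∑≡⇒≗ (∑-inClass*inc≤1 C) incidences
    where
    open ≡-Reasoning
    incidences : ∑[ p < q * q ] ∑[ l < q * q + q ] (inClass C l * inc p l) ≡ ∑[ p < q * q ] 1
    incidences = begin
      ∑[ p < q * q ] ∑[ l < q * q + q ] (inClass C l * inc p l)
        ≡⟨ ∑-comm (λ p l → inClass C l * inc p l) ⟩
      ∑[ l < q * q + q ] ∑[ p < q * q ] (inClass C l * inc p l)
        ≡⟨ sum-cong-≗ (λ l → *-distribˡ-sum (inClass C l) (λ p → inc p l)) ⟨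
      ∑[ l < q * q + q ] (inClass C l * ∑[ p < q * q ] inc p l)
        ≡⟨ sum-cong-≗ (λ l → cong (inClass C l *_) (∑-inc l)) ⟩
      ∑[ l < q * q + q ] (inClass C l * q)
        ≡⟨ *-distribʳ-sum q (inClass C) ⟨
      ∑[ l < q * q + q ] inClass C l * q
        ≡⟨ cong (_* q) (∑-inClass C) ⟩
      q * q
        ≡⟨ trans (∑-const (q * q) 1) (*-identityʳ (q * q)) ⟨
      ∑[ p < q * q ] 1 ∎

  -- l meets each of the q lines of the class of l′ at most once, and each of its q points lies
  -- on one of them, so it meets every one of them exactly once.
  nonParallel⇒∑inc*inc≡1 : ∀ {l l′} → ¬ Parallel l l′ →
                           ∑[ p < q * q ] (inc p l * inc p l′) ≡ 1
  nonParallel⇒∑inc*inc≡1 {l} {l′} l∦l′ = begin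
    meet l′                 ≡⟨ *-identityˡ (meet l′) ⟨
    1 * meet l′             ≡⟨ cong (_* meet l′) l′∈C ⟨
    inClass C l′ * meet l′  ≡⟨ ≤-pointwise∧∑≡⇒≗ meet≤1 total l′ ⟩
    inClass C l′            ≡⟨ l′∈C ⟩
    1                       ∎
    where
    open ≡-Reasoning
    C : Fin (suc q)
    C = parClass l′
    meet : Line → ℕ
    meet l″ = ∑[ p < q * q ] (inc p l * inc p l″)
    l′∈C : inClass C l′ ≡ 1
    l′∈C = cong 𝟙 (≟-self C)
    meet≤1 : ∀ l″ → inClass C l″ * meet l″ ≤ inClass C l″
    meet≤1 l″ with parClass l″ ≟ C
    ... | no _    = z≤n
    ... | yes l″∈C = ≤-trans (≤-reflexive (+-identityʳ (meet l″)))
      (∑𝟙*𝟙≤1 (λ p → I p l) (λ p → I p l″) (meetAtMostOne l l″ l≢l″ _ _))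
      where
      l≢l″ : l ≢ l″
      l≢l″ l≡l″ = l∦l′ (trans (cong parClass l≡l″) l″∈C)
    total : ∑[ l″ < q * q + q ] (inClass C l″ * meet l″) ≡ ∑[ l″ < q * q + q ] inClass C l″
    total = begin
      ∑[ l″ < q * q + q ] (inClass C l″ * meet l″)
        ≡⟨ ∑-*-∑-comm (inClass C) (λ p → inc p l) (λ l″ p → inc p l″) ⟩
      ∑[ p < q * q ] (inc p l * ∑[ l″ < q * q + q ] (inClass C l″ * inc p l″))
        ≡⟨ sum-cong-≗ (λ p → trans (cong (inc p l *_) (∑-inClass*inc≡1 C p))
                                   (*-identityʳ (inc p l))) ⟩
      ∑[ p < q * q ] inc p l
        ≡⟨ trans (∑-inc l) (sym (∑-inClass C)) ⟩
      ∑[ l″ < q * q + q ] inClass C l″ ∎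

  module Pencil (L : Fin (suc q) → Line) (L-nonParallel : PairwiseNonParallel L) where

    L-injective : ∀ {i j} → L i ≡ L j → i ≡ j
    L-injective {i} {j} Lᵢ≡Lⱼ =
      decidable-stable (i ≟ j) λ i≢j → L-nonParallel i j i≢j (cong parClass Lᵢ≡Lⱼ)

    χ : Point → Fin (suc q) → ℕ
    χ p i = inc p (L i)

    weightedMultiplicity : (Fin (suc q) → ℕ) → Point → ℕ
    weightedMultiplicity w p = ∑[ i < suc q ] (w i * χ p i)

    intersectionSize : Fin (suc q) → Fin (suc q) → ℕ
    intersectionSize i j = ∑[ p < q * q ] (χ p i * χ p j)

    intersectionSize-self : ∀ i → intersectionSize i i ≡ q
    intersectionSize-self i = ∑-inc*inc-self (L i)

    intersectionSize-distinct : ∀ {i j} → i ≢ j → intersectionSize i j ≡ 1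
    intersectionSize-distinct i≢j = nonParallel⇒∑inc*inc≡1 (L-nonParallel _ _ i≢j)

    ∑-intersectionSize-row : ∀ i (v : Fin (suc q) → ℕ) →
      ∑[ j < suc q ] (v j * intersectionSize i j) + v i ≡ ∑[ j < suc q ] v j + q * v i
    ∑-intersectionSize-row i v = begin
      ∑[ j < suc q ] (v j * intersectionSize i j) + v i
        ≡⟨ cong (_+ v i) (sum-remove {i = i} (λ j → v j * intersectionSize i j)) ⟩
      v i * intersectionSize i i + ∑[ j < q ] (v (punchIn i j) * intersectionSize i (punchIn i j)) + v i
        ≡⟨ cong₂ (λ x y → v i * x + y + v i) (intersectionSize-self i) (sum-cong-≗ off-diagonal) ⟩
      v i * q + ∑[ j < q ] v (punchIn i j) + v i
        ≡⟨ rearrange (v i) q _ ⟩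
      v i + ∑[ j < q ] v (punchIn i j) + q * v i
        ≡⟨ cong (_+ q * v i) (sum-remove {i = i} v) ⟨
      ∑[ j < suc q ] v j + q * v i ∎
      where
      open ≡-Reasoning
      off-diagonal : ∀ j → v (punchIn i j) * intersectionSize i (punchIn i j) ≡ v (punchIn i j)
      off-diagonal j = trans (cong (v (punchIn i j) *_) (intersectionSize-distinct (punchInᵢ≢i i j ∘ sym)))
                             (*-identityʳ (v (punchIn i j)))
      rearrange : ∀ x q r → x * q + r + x ≡ x + r + q * x
      rearrange = solve-∀

    ∑-weightedMultiplicity : ∀ w →
      ∑[ p < q * q ] weightedMultiplicity w p ≡ ∑[ i < suc q ] w i * q
    ∑-weightedMultiplicity w = begin
      ∑[ p < q * q ] ∑[ i < suc q ] (w i * χ p i)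
        ≡⟨ ∑-comm (λ p i → w i * χ p i) ⟩
      ∑[ i < suc q ] ∑[ p < q * q ] (w i * χ p i)
        ≡⟨ sum-cong-≗ (λ i → *-distribˡ-sum (w i) (λ p → χ p i)) ⟨
      ∑[ i < suc q ] (w i * ∑[ p < q * q ] χ p i)
        ≡⟨ sum-cong-≗ (λ i → cong (w i *_) (∑-inc (L i))) ⟩
      ∑[ i < suc q ] (w i * q)
        ≡⟨ *-distribʳ-sum q w ⟨
      ∑[ i < suc q ] w i * q ∎
      where open ≡-Reasoning

    ∑-weightedMultiplicity² : ∀ u v →
      ∑[ p < q * q ] (weightedMultiplicity u p * weightedMultiplicity v p) + ∑[ i < suc q ] (u i * v i)
        ≡ ∑[ i < suc q ] u i * ∑[ i < suc q ] v i + q * ∑[ i < suc q ] (u i * v i)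
    ∑-weightedMultiplicity² u v = begin
      ∑[ p < q * q ] (mu p * mv p) + ∑[ i < suc q ] (u i * v i)
        ≡⟨ cong (_+ ∑[ i < suc q ] (u i * v i)) expand ⟩
      ∑[ i < suc q ] (u i * row i) + ∑[ i < suc q ] (u i * v i)
        ≡⟨ ∑-distrib-+ (λ i → u i * row i) (λ i → u i * v i) ⟨
      ∑[ i < suc q ] (u i * row i + u i * v i)
        ≡⟨ sum-cong-≗ (λ i → trans (sym (*-distribˡ-+ (u i) (row i) (v i)))
                                   (cong (u i *_) (∑-intersectionSize-row i v))) ⟩
      ∑[ i < suc q ] (u i * (∑[ j < suc q ] v j + q * v i))
        ≡⟨ sum-cong-≗ (λ i → distribute (u i) (∑[ j < suc q ] v j) q (v i)) ⟩
      ∑[ i < suc q ] (u i * ∑[ j < suc q ] v j + q * (u i * v i))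
        ≡⟨ ∑-distrib-+ (λ i → u i * ∑[ j < suc q ] v j) (λ i → q * (u i * v i)) ⟩
      ∑[ i < suc q ] (u i * ∑[ j < suc q ] v j) + ∑[ i < suc q ] (q * (u i * v i))
        ≡⟨ cong₂ _+_ (*-distribʳ-sum (∑[ j < suc q ] v j) u) (*-distribˡ-sum q (λ i → u i * v i)) ⟨
      ∑[ i < suc q ] u i * ∑[ i < suc q ] v i + q * ∑[ i < suc q ] (u i * v i) ∎
      where
      open ≡-Reasoning
      mu mv : Point → ℕ
      mu = weightedMultiplicity u
      mv = weightedMultiplicity v
      row : Fin (suc q) → ℕ
      row i = ∑[ j < suc q ] (v j * intersectionSize i j)
      distribute : ∀ x s q y → x * (s + q * y) ≡ x * s + q * (x * y)
      distribute = solve-∀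
      expand : ∑[ p < q * q ] (mu p * mv p) ≡ ∑[ i < suc q ] (u i * row i)
      expand = begin
        ∑[ p < q * q ] (mu p * mv p)
          ≡⟨ sum-cong-≗ (λ p → *-comm (mu p) (mv p)) ⟩
        ∑[ p < q * q ] (mv p * ∑[ i < suc q ] (u i * χ p i))
          ≡⟨ ∑-*-∑-comm mv u χ ⟩
        ∑[ i < suc q ] (u i * ∑[ p < q * q ] (mv p * χ p i))
          ≡⟨ sum-cong-≗ (λ i → cong (u i *_) (sum-cong-≗ (λ p → *-comm (mv p) (χ p i)))) ⟩
        ∑[ i < suc q ] (u i * ∑[ p < q * q ] (χ p i * ∑[ j < suc q ] (v j * χ p j)))
          ≡⟨ sum-cong-≗ (λ i → cong (u i *_) (∑-*-∑-comm (λ p → χ p i) v χ)) ⟩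
        ∑[ i < suc q ] (u i * row i) ∎

    module MaximalKnot (p₀ : Point) (p₀-max : ∀ p → multiplicity L p ≤ multiplicity L p₀)
                       (0<q : 0 < q) where

      m : Point → ℕ
      m = multiplicity L

      M K : ℕ
      M = m p₀
      K = kakeyaSize L

      through avoiding : Fin (suc q) → ℕ
      through i  = χ p₀ i
      avoiding i = 𝟙 (not (I p₀ (L i)))

      k : ℕ
      k = ∑[ i < suc q ] avoiding i

      s r : Point → ℕ
      s = weightedMultiplicity through
      r = weightedMultiplicity avoiding

      m≡μ[1] : ∀ p → m p ≡ weightedMultiplicity (λ _ → 1) p
      m≡μ[1] p =
        trans (count≡∑ (λ i → I p (L i))) (sum-cong-≗ (λ i → sym (*-identityˡ (χ p i))))

      ∑1≡1+q : ∑[ i < suc q ] 1 ≡ suc q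
      ∑1≡1+q = trans (∑-const (suc q) 1) (*-identityʳ (suc q))

      ∑m≡[1+q]*q : ∑[ p < q * q ] m p ≡ suc q * q
      ∑m≡[1+q]*q = trans (sum-cong-≗ m≡μ[1])
                         (trans (∑-weightedMultiplicity (λ _ → 1)) (cong (_* q) ∑1≡1+q))

      ∑m*m≡2*[1+q]*q : ∑[ p < q * q ] (m p * m p) ≡ suc q * q + suc q * q
      ∑m*m≡2*[1+q]*q = +-cancelʳ-≡ (suc q) _ _ (begin
        ∑[ p < q * q ] (m p * m p) + suc q
          ≡⟨ cong₂ _+_ (sum-cong-≗ (λ p → cong₂ _*_ (m≡μ[1] p) (m≡μ[1] p))) (sym ∑1≡1+q) ⟩
        ∑[ p < q * q ] (weightedMultiplicity (λ _ → 1) p * weightedMultiplicity (λ _ → 1) p)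
          + ∑[ i < suc q ] 1
          ≡⟨ ∑-weightedMultiplicity² (λ _ → 1) (λ _ → 1) ⟩
        ∑[ i < suc q ] 1 * ∑[ i < suc q ] 1 + q * ∑[ i < suc q ] 1
          ≡⟨ cong (λ n → n * n + q * n) ∑1≡1+q ⟩
        suc q * suc q + q * suc q
          ≡⟨ solve (q ∷ []) ⟩
        suc q * q + suc q * q + suc q ∎)
        where open ≡-Reasoning

      K≡∑m⊓1 : K ≡ ∑[ p < q * q ] (m p ⊓ 1)
      K≡∑m⊓1 = trans (count≡∑ (inKakeya L))
                     (sum-cong-≗ (λ p → 𝟙[anyFin]≡count⊓1 (λ i → I p (L i))))

      M≡∑through : M ≡ ∑[ i < suc q ] through i
      M≡∑through = count≡∑ (λ i → I p₀ (L i))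

      ∑through*avoiding≡0 : ∑[ i < suc q ] (through i * avoiding i) ≡ 0
      ∑through*avoiding≡0 =
        trans (sum-cong-≗ (λ i → 𝟙*𝟙[not]≡0 (I p₀ (L i)))) (sum-replicate-zero (suc q))

      through+avoiding≡1 : ∀ i → through i + avoiding i ≡ 1
      through+avoiding≡1 i = 𝟙+𝟙[not]≡1 (I p₀ (L i))

      M+k≡1+q : M + k ≡ suc q
      M+k≡1+q = begin
        M + k                                    ≡⟨ cong (_+ k) M≡∑through ⟩
        ∑[ i < suc q ] through i + k             ≡⟨ ∑-distrib-+ through avoiding ⟨
        ∑[ i < suc q ] (through i + avoiding i)  ≡⟨ sum-cong-≗ through+avoiding≡1 ⟩
        ∑[ i < suc q ] 1                         ≡⟨ ∑1≡1+q ⟩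
        suc q                                    ∎
        where open ≡-Reasoning

      0<M : 0 < M
      0<M = n≢0⇒n>0 λ M≡0 → <⇒≱ 0<∑m (begin
        ∑[ p < q * q ] m p  ≤⟨ ∑-mono-≤ p₀-max ⟩
        ∑[ p < q * q ] M    ≡⟨ ∑-const (q * q) M ⟩
        q * q * M           ≡⟨ cong (q * q *_) M≡0 ⟩
        q * q * 0           ≡⟨ *-zeroʳ (q * q) ⟩
        0                   ∎)
        where
        open ≤-Reasoning
        0<∑m : 0 < ∑[ p < q * q ] m p
        0<∑m = subst (0 <_) (sym ∑m≡[1+q]*q) (≤-trans 0<q (m≤m+n q (q * q)))

      a : ℕ
      a = pred M

      M≡1+a : M ≡ suc a
      M≡1+a = sym (suc-pred M {{>-nonZero 0<M}})

      a+k≡q : a + k ≡ q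
      a+k≡q = suc-injective (trans (cong (_+ k) (sym M≡1+a)) M+k≡1+q)

      s+r≡m : ∀ p → s p + r p ≡ m p
      s+r≡m p = begin
        s p + r p
          ≡⟨ ∑-distrib-+ (λ i → through i * χ p i) (λ i → avoiding i * χ p i) ⟨
        ∑[ i < suc q ] (through i * χ p i + avoiding i * χ p i)
          ≡⟨ sum-cong-≗ (λ i → *-distribʳ-+ (χ p i) (through i) (avoiding i)) ⟨
        ∑[ i < suc q ] ((through i + avoiding i) * χ p i)
          ≡⟨ sum-cong-≗ (λ i → cong (_* χ p i) (through+avoiding≡1 i)) ⟩
        ∑[ i < suc q ] (1 * χ p i)
          ≡⟨ m≡μ[1] p ⟨
        m p ∎
        where open ≡-Reasoning

      K≡∑[s+r]⊓1 : K ≡ ∑[ p < q * q ] ((s p + r p) ⊓ 1)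
      K≡∑[s+r]⊓1 = trans K≡∑m⊓1 (sum-cong-≗ (λ p → cong (_⊓ 1) (sym (s+r≡m p))))

      s[p₀]≡1+a : s p₀ ≡ suc a
      s[p₀]≡1+a =
        trans (sum-cong-≗ (λ i → 𝟙*𝟙≡𝟙 (I p₀ (L i)))) (trans (sym M≡∑through) M≡1+a)

      r[p₀]≡0 : r p₀ ≡ 0
      r[p₀]≡0 = trans (sum-cong-≗ (λ i → *-comm (avoiding i) (through i))) ∑through*avoiding≡0

      s≤1 : ∀ {p} → p ≢ p₀ → s p ≤ 1
      s≤1 {p} p≢p₀ = ∑𝟙*𝟙≤1 (λ i → I p₀ (L i)) (λ i → I p (L i))
        λ {i} {j} p₀∈Lᵢ p∈Lᵢ p₀∈Lⱼ p∈Lⱼ →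
          L-injective (joinUnique p₀ p (p≢p₀ ∘ sym) (L i) (L j) p₀∈Lᵢ p∈Lᵢ p₀∈Lⱼ p∈Lⱼ)

      ∑s*r≡M*k : ∑[ p < q * q ] (s p * r p) ≡ M * k
      ∑s*r≡M*k = +-cancelʳ-≡ 0 _ _ (begin
        ∑[ p < q * q ] (s p * r p) + 0
          ≡⟨ cong (∑[ p < q * q ] (s p * r p) +_) ∑through*avoiding≡0 ⟨
        ∑[ p < q * q ] (s p * r p) + ∑[ i < suc q ] (through i * avoiding i)
          ≡⟨ ∑-weightedMultiplicity² through avoiding ⟩
        ∑[ i < suc q ] through i * k + q * ∑[ i < suc q ] (through i * avoiding i)
          ≡⟨ cong₂ (λ x y → x * k + q * y) (sym M≡∑through) ∑through*avoiding≡0 ⟩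
        M * k + q * 0
          ≡⟨ cong (M * k +_) (*-zeroʳ q) ⟩
        M * k + 0 ∎)
        where open ≡-Reasoning

      upperBound : K + k * q ≤ q * q + k * k
      upperBound = upperBound-arith {K = K} a+k≡q
        (subst (λ M → K + M * k + a ≤ M * q + k * q) M≡1+a (begin
        K + M * k + a
          ≡⟨ cong₂ (λ x y → x + y + a) K≡∑[s+r]⊓1 (sym ∑s*r≡M*k) ⟩
        ∑[ p < q * q ] ((s p + r p) ⊓ 1) + ∑[ p < q * q ] (s p * r p) + a
          ≡⟨ cong (_+ a) (∑-distrib-+ (λ p → (s p + r p) ⊓ 1) (λ p → s p * r p)) ⟨
        ∑[ p < q * q ] ((s p + r p) ⊓ 1 + s p * r p) + a
          ≤⟨ ∑-mono-≤-except p₀ (λ p p≢p₀ → [s+r]⊓1+s*r≤s+r (r p) (s≤1 p≢p₀))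
                                ([s+r]⊓1+s*r+a≤s+r+0 s[p₀]≡1+a r[p₀]≡0) ⟩
        ∑[ p < q * q ] (s p + r p) + 0
          ≡⟨ +-identityʳ _ ⟩
        ∑[ p < q * q ] (s p + r p)
          ≡⟨ ∑-distrib-+ s r ⟩
        ∑[ p < q * q ] s p + ∑[ p < q * q ] r p
          ≡⟨ cong₂ _+_ (trans (∑-weightedMultiplicity through) (cong (_* q) (sym M≡∑through)))
                       (∑-weightedMultiplicity avoiding) ⟩
        M * q + k * q ∎))
        where open ≤-Reasoning

      lowerBound : 2 * (q * q) + k * (k + 1) ≤ 2 * K + 2 * (k * q)
      lowerBound = lowerBound-arith {K = K} a+k≡q (begin
        3 * (suc q * q) + a * a
          ≡⟨ cong (λ x → 3 * x + a * a) ∑m≡[1+q]*q ⟨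
        3 * ∑[ p < q * q ] m p + a * a
          ≡⟨ cong (_+ a * a) (*-distribˡ-sum 3 m) ⟩
        ∑[ p < q * q ] (3 * m p) + a * a
          ≤⟨ ∑-mono-≤-except p₀ (λ p _ → 3*m≤2*[m⊓1]+m*m (m p))
                                (3*m+a*a≤2*[m⊓1]+m*m+a M≡1+a) ⟩
        ∑[ p < q * q ] (2 * (m p ⊓ 1) + m p * m p) + a
          ≡⟨ cong (_+ a) (∑-distrib-+ (λ p → 2 * (m p ⊓ 1)) (λ p → m p * m p)) ⟩
        ∑[ p < q * q ] (2 * (m p ⊓ 1)) + ∑[ p < q * q ] (m p * m p) + a
          ≡⟨ cong₂ (λ x y → x + y + a) (sym (*-distribˡ-sum 2 (λ p → m p ⊓ 1))) ∑m*m≡2*[1+q]*q ⟩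
        2 * ∑[ p < q * q ] (m p ⊓ 1) + (suc q * q + suc q * q) + a
          ≡⟨ cong (λ x → 2 * x + (suc q * q + suc q * q) + a) K≡∑m⊓1 ⟨
        2 * K + (suc q * q + suc q * q) + a ∎)
        where open ≤-Reasoning

      ∑m*m+M*K≤[1+M]*∑m : suc q * q + suc q * q + M * K ≤ suc M * (suc q * q)
      ∑m*m+M*K≤[1+M]*∑m = begin
        suc q * q + suc q * q + M * K
          ≡⟨ cong₂ (λ x y → x + M * y) (sym ∑m*m≡2*[1+q]*q) K≡∑m⊓1 ⟩
        ∑[ p < q * q ] (m p * m p) + M * ∑[ p < q * q ] (m p ⊓ 1)
          ≡⟨ cong (∑[ p < q * q ] (m p * m p) +_) (*-distribˡ-sum M (λ p → m p ⊓ 1)) ⟩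
        ∑[ p < q * q ] (m p * m p) + ∑[ p < q * q ] (M * (m p ⊓ 1))
          ≡⟨ ∑-distrib-+ (λ p → m p * m p) (λ p → M * (m p ⊓ 1)) ⟨
        ∑[ p < q * q ] (m p * m p + M * (m p ⊓ 1))
          ≤⟨ ∑-mono-≤ (λ p → m*m+M*[m⊓1]≤[1+M]*m (p₀-max p)) ⟩
        ∑[ p < q * q ] (suc M * m p)
          ≡⟨ *-distribˡ-sum (suc M) m ⟨
        suc M * ∑[ p < q * q ] m p
          ≡⟨ cong (suc M *_) ∑m≡[1+q]*q ⟩
        suc M * (suc q * q) ∎
        where open ≤-Reasoning

      p₀-knot : IsKnot L (suc q ∸ k) p₀
      p₀-knot = sym (trans (cong (_∸ k) (sym M+k≡1+q)) (m+n∸n≡m M k))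

      p₀∈K : inKakeya L p₀ ≡ true
      p₀∈K = 𝟙≡1⇒≡true (trans (𝟙[anyFin]≡count⊓1 (λ i → I p₀ (L i)))
                              (m≥n⇒m⊓n≡n 0<M))

      K*[1+a]≤[1+q]*q*a : K * suc a ≤ suc q * q * a
      K*[1+a]≤[1+q]*q*a = K*[1+a]≤S*a {suc q * q}
        (subst (λ M → suc q * q + suc q * q + M * K ≤ suc M * (suc q * q))
               M≡1+a ∑m*m+M*K≤[1+M]*∑m)

      floorBound : ∀ {f} → a ≤ f → f ≤ q → K * (f + 1) + q * (q ∸ f) ≤ q * q * (f + 1)
      floorBound {f} a≤f f≤q = begin
        K * (f + 1) + q * (q ∸ f)
          ≤⟨ +-monoˡ-≤ (q * (q ∸ f))
                       (x*[1+a]≤y*a⇒x*[f+1]≤y*f K (suc q * q) K*[1+a]≤[1+q]*q*a a≤f) ⟩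
        suc q * q * f + q * (q ∸ f)
          ≡⟨ [1+q]*q*f+q*[q∸f]≡q*q*[f+1] f≤q ⟩
        q * q * (f + 1) ∎
        where open ≤-Reasoning

      ceilBound : ∀ {c} → c ≤ a → c ≤ k → K + c * (q ∸ c) ≤ q * q
      ceilBound {c} c≤a c≤k = begin
        K + c * (q ∸ c)  ≤⟨ +-monoʳ-≤ K (c*[q∸c]≤k*[q∸k] c≤k k+c≤q) ⟩
        K + k * (q ∸ k)  ≤⟨ K+k*[q∸k]≤q*q {K} (m+n≤o⇒m≤o k k+c≤q) upperBound ⟩
        q * q            ∎
        where
        open ≤-Reasoning
        k+c≤q : k + c ≤ q
        k+c≤q = subst (k + c ≤_) (trans (+-comm k a) a+k≡q) (+-monoʳ-≤ k c≤a)

theorem2p3 : (q : ℕ) → 2 ≤ q → (A : AffinePlane q) →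
  let open AffinePlane A in
  (L : Fin (suc q) → Line) → PairwiseNonParallel L →
  let K = kakeyaSize L
      c = ceilκ q
      f = floorκ q
  in
  -- |K| > q² − ⌈κ⌉(q − ⌈κ⌉)
  q * q < K + c * (q ∸ c) →
  -- |K| > q² − q(q − ⌊κ⌋)/(⌊κ⌋+1), multiplied through by ⌊κ⌋+1
  q * q * (f + 1) < K * (f + 1) + q * (q ∸ f) →
  Σ ℕ λ k → k < c ×
    (Σ Point λ p → (inKakeya L p ≡ true) × IsKnot L (suc q ∸ k) p) ×
    -- q² − kq + k(k+1)/2 ≤ |K|, multiplied by 2
    (2 * (q * q) + k * (k + 1) ≤ 2 * K + 2 * (k * q)) ×
    -- |K| ≤ q² − kq + k²
    (K + k * q ≤ q * q + k * k)
theorem2p3 zero ()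
theorem2p3 q@(suc _) _ A L L-nonParallel h₁ h₂ =
  k , k<c , (p₀ , p₀∈K , p₀-knot) , lowerBound , upperBound
  where
  open AffinePlane A using (Point; multiplicity)
  open Pencil A L L-nonParallel
  maximum : ∃ λ p → ∀ x → multiplicity L x ≤ multiplicity L p
  maximum = argmax (multiplicity L)
  p₀ : Point
  p₀ = proj₁ maximum
  open MaximalKnot p₀ (proj₂ maximum) (s≤s z≤n)
  f<a : floorκ q < a
  f<a = ≰⇒> λ a≤f → ≤⇒≯ (floorBound a≤f (floorκ≤ q)) h₂
  k<c : k < ceilκ q
  k<c = ≰⇒> λ c≤k → ≤⇒≯ (ceilBound (≤-trans (ceilκ≤1+floorκ q) f<a) c≤k) h₁
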